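{- Let $c$ be a vector of $d$ non-negative integers, let $k \in \mathbb{N}_+$ be a sparsity, $b \in \mathbb{N}_+$ a block size and $\Delta \in \mathbb{N}_+$. Define $c^b \in \mathbb{Z}^{d-b+1}$ by $c^b_i := \sum_{j=i}^{i+b-1} c_j$. Let $S$ be a set of indices corresponding to an optimal solution of the $(\Delta + b - 1)$-separated problem for cost vector $c^b$ and sparsity $k$. Then $S$ is an optimal solution of the $(\Delta, b)$-separated problem for cost vector $c$ and sparsity $k$.
   Context: For a cost vector $a \in \mathbb{R}^{n}$, sparsity $k$ and separation $D$, the $D$-separated problem asks for a set $S \subseteq \{1,\dots,n\}$ with $|S| = k$ and $|i - j| \ge D$ for all distinct $i,j \in S$ maximizing $\sum_{i\in S} a_i$. The $(\Delta,b)$-separated problem for $c \in \mathbb{R}^d$ and sparsity $k$ asks for $k$ indices $p_1,\dots,p_k$ with $1 \le p_i \le d - b + 1$ for all $i$, $|p_i - p_j| \ge \Delta + b - 1$ for all $i \neq j$, maximizing $\sum_{i=1}^k \sum_{j=0}^{b-1} c_{p_i + j}$. -}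

module Defs where

open import Data.Nat using (ℕ; zero; suc; _+_; _∸_; _≤_; _<?_; ∣_-_∣)
open import Data.Fin using (Fin; toℕ; fromℕ<)
open import Data.Vec using (Vec; lookup; tabulate)
open import Data.List using (List; length; map)
open import Data.Nat.ListAction using (sum)
open import Data.List.Relation.Unary.AllPairs using (AllPairs)
open import Data.Product using (_×_)
open import Relation.Binary.PropositionalEquality using (_≡_; _≢_)
open import Relation.Nullary using (yes; no)

-- Conventions: indices are 0-based (paper index i corresponds to i - 1 here).

-- Entry i of a vector, 0 if out of range (only used at in-range positions).
get : ∀ {d} → Vec ℕ d → ℕ → ℕ
get {d} c i with i <? d
... | yes i<d = lookup c (fromℕ< i<d)
... | no _ = 0

blockSum : ∀ {d} → Vec ℕ d → ℕ → ℕ → ℕ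
blockSum c zero i = 0
blockSum c (suc b) i = blockSum c b i + get c (i + b)

blockVec : ∀ {d} → Vec ℕ d → (b : ℕ) → Vec ℕ (d + 1 ∸ b)
blockVec c b = tabulate (λ i → blockSum c b (toℕ i))

-- D-separated problem for a ∈ ℕ^n, sparsity k.
-- A solution S ⊆ {1..n}, |S| = k, is given as a duplicate-free list.

SepFeasible : ∀ {n} → ℕ → ℕ → List (Fin n) → Set
SepFeasible D k S =
  length S ≡ k × AllPairs (λ i j → i ≢ j × D ≤ ∣ toℕ i - toℕ j ∣) S

sepValue : ∀ {n} → Vec ℕ n → List (Fin n) → ℕ
sepValue a S = sum (map (lookup a) S)

SepOptimal : ∀ {n} → (a : Vec ℕ n) → (D k : ℕ) → List (Fin n) → Set
SepOptimal a D k S =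
  SepFeasible D k S × (∀ T → SepFeasible D k T → sepValue a T ≤ sepValue a S)

-- A solution is a k-tuple (p_1,…,p_k) (a list of length k) with
-- 1 ≤ p_i ≤ d-b+1 (i.e. p_i ∈ Fin (d + 1 ∸ b), 0-based) and
-- |p_i - p_j| ≥ Δ + b - 1 for i ≠ j.

BlockFeasible : ∀ {d} → (Δ b k : ℕ) → List (Fin (d + 1 ∸ b)) → Set
BlockFeasible Δ b k P =
  length P ≡ k × AllPairs (λ p q → Δ + b ∸ 1 ≤ ∣ toℕ p - toℕ q ∣) P

blockValue : ∀ {d} → Vec ℕ d → (b : ℕ) → List (Fin (d + 1 ∸ b)) → ℕ
blockValue c b P = sum (map (λ p → blockSum c b (toℕ p)) P)

BlockOptimal : ∀ {d} → (c : Vec ℕ d) → (Δ b k : ℕ) → List (Fin (d + 1 ∸ b)) → Set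
BlockOptimal c Δ b k P =
  BlockFeasible Δ b k P × (∀ Q → BlockFeasible Δ b k Q → blockValue c b Q ≤ blockValue c b P)

module Submission where

-- The (Δ,b)-separated problem for c is the (Δ + b - 1)-separated problem for
-- the block-sum vector c^b, read differently:
--   * objective: choosing index p in the separated problem for c^b gains
--     c^b_p = Σ_{j<b} c_{p+j}, exactly the block gain of p, so both problems
--     assign the same value to every list of indices (value-correspondence);
--   * constraints: both demand length k and pairwise distance ≥ Δ + b - 1;
--     the separated problem additionally demands distinct indices, which is
--     implied by a positive separation (Δ + b - 1 ≥ 1 since Δ, b ≥ 1).
-- Hence the two problems have the same feasible sets and the same objective,
-- and an optimum of one is an optimum of the other.

open import Defs
open import Data.Nat using (ℕ; suc; _+_; _∸_; _≤_; s≤s; z≤n; ∣_-_∣)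
open import Data.Nat.Properties using (∣n-n∣≡0; +-suc; ≤-trans)
open import Data.Fin using (Fin; toℕ)
open import Data.Vec using (Vec)
open import Data.Vec.Properties using (lookup∘tabulate)
open import Data.List using (List; []; _∷_)
open import Data.List.Relation.Unary.AllPairs as AllPairs using ()
open import Data.Product using (_,_; proj₂)
open import Relation.Binary.PropositionalEquality using (_≡_; _≢_; refl; cong₂; subst; subst₂)

value-correspondence : ∀ {d} (c : Vec ℕ d) (b : ℕ) (P : List (Fin (d + 1 ∸ b))) →
  sepValue (blockVec c b) P ≡ blockValue c b P
value-correspondence c b [] = refl
value-correspondence c b (p ∷ P) =
  cong₂ _+_ (lookup∘tabulate _ p) (value-correspondence c b P)

separated⇒distinct : ∀ {n D} {i j : Fin n} → 1 ≤ D → D ≤ ∣ toℕ i - toℕ j ∣ → i ≢ j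
separated⇒distinct {i = i} 1≤D sep refl
  with ≤-trans 1≤D (subst (_ ≤_) (∣n-n∣≡0 (toℕ i)) sep)
... | ()

block-separation-positive : ∀ b Δ → 1 ≤ b → 1 ≤ Δ → 1 ≤ Δ + b ∸ 1
block-separation-positive (suc b) (suc Δ) _ _ rewrite +-suc Δ b = s≤s z≤n

sepFeasible⇒blockFeasible : ∀ {d} (Δ b k : ℕ) (P : List (Fin (d + 1 ∸ b))) →
  SepFeasible (Δ + b ∸ 1) k P → BlockFeasible Δ b k P
sepFeasible⇒blockFeasible Δ b k P (length≡k , separated) =
  length≡k , AllPairs.map proj₂ separated

blockFeasible⇒sepFeasible : ∀ {d} (Δ b k : ℕ) (P : List (Fin (d + 1 ∸ b))) →
  1 ≤ Δ + b ∸ 1 → BlockFeasible Δ b k P → SepFeasible (Δ + b ∸ 1) k P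
blockFeasible⇒sepFeasible Δ b k P positive (length≡k , separated) =
  length≡k , AllPairs.map (λ sep → separated⇒distinct positive sep , sep) separated

theorem7 : (d : ℕ) (c : Vec ℕ d) (k b Δ : ℕ) → 1 ≤ k → 1 ≤ b → 1 ≤ Δ →
    (S : List (Fin (d + 1 ∸ b))) →
    SepOptimal (blockVec c b) (Δ + b ∸ 1) k S →
    BlockOptimal c Δ b k S
theorem7 d c k b Δ _ 1≤b 1≤Δ S (S-feasible , S-optimal) =
  sepFeasible⇒blockFeasible Δ b k S S-feasible , S-beats
  where
  S-beats : ∀ Q → BlockFeasible Δ b k Q → blockValue c b Q ≤ blockValue c b S
  S-beats Q Q-feasible =
    subst₂ _≤_ (value-correspondence c b Q) (value-correspondence c b S)
      (S-optimal Q (blockFeasible⇒sepFeasible Δ b k Q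
        (block-separation-positive b Δ 1≤b 1≤Δ) Q-feasible))
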